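{- Let $R\ge 0$ and let $c(x)=\sum_{i=0}^n c_ix^i$ be a primitive polynomial of degree $n$ over $\mathrm{GF}(2)$ with $c_0=c_n=1$ and $c_i=0$ for $1\le i\le 2R+1$. Let $\mathcal{A}$ be the cyclic sequence of length $2^n-1$ (one period) generated by $a_k=\sum_{i=1}^n c_ia_{k-i}$ (mod 2) from a nonzero initial $n$-tuple, and let $\mathcal{B}$ be the cyclic sequence of length $2^n-1$ (one period) generated by $b_k=\sum_{i=1}^n c_ib_{k-i}+1$ (mod 2) from an initial $n$-tuple different from the all-ones tuple. Then the code consisting of the four cyclic sequences $\mathcal{A}$, $\mathcal{B}$, the all-zero sequence $[0]$ and the all-one sequence $[1]$ is an $(n+2R+1,R)$-covering sequence code.
   Context: A cyclic binary sequence $[s_0,\ldots,s_{k-1}]$ of length $k$ has as its windows of length $N$ the words $(s_i,\ldots,s_{i+N-1})$, $0\le i\le k-1$, indices modulo $k$ (so e.g. the only window of $[0]$ is the all-zero word). A set of cyclic binary sequences (possibly of different lengths) is an $(N,R)$-covering sequence code if for every $x\in\{0,1\}^N$ there is a window $w$ of length $N$ of one of the sequences with Hamming distance $d(x,w)\le R$. A polynomial over $\mathrm{GF}(2)$ of degree $n$ is primitive if it is irreducible and its roots have multiplicative order $2^n-1$. -}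

module Defs where

open import Data.Bool using (Bool; true; false; _xor_; _∧_; if_then_else_)
open import Data.Nat using (ℕ; zero; suc; _+_; _∸_; _^_; _≤_; _<_)
open import Data.Nat.DivMod using (_mod_)
open import Data.Fin using (Fin; toℕ)
open import Data.List using (List; []; _∷_; replicate; _++_)
open import Data.List.Membership.Propositional using (_∈_)
open import Data.Vec as Vec using (Vec; tabulate; _∷ʳ_; zipWith)
open import Data.Product using (Σ; ∃; _×_)
open import Relation.Binary.PropositionalEquality using (_≡_)
open import Relation.Nullary using (¬_)

-- Polynomials over GF(2) = Bool (true = 1, xor = +, ∧ = ·),
-- as coefficient lists, lowest degree first.

Poly : Set
Poly = List Bool

coeff : Poly → ℕ → Bool
coeff []       _       = false
coeff (a ∷ _)  zero    = a
coeff (_ ∷ p)  (suc i) = coeff p i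

addP : Poly → Poly → Poly
addP []       q        = q
addP p        []       = p
addP (a ∷ p)  (b ∷ q)  = (a xor b) ∷ addP p q

mulP : Poly → Poly → Poly
mulP []       q = []
mulP (a ∷ p)  q = addP (if a then q else []) (false ∷ mulP p q)

-- equality of polynomials (coefficientwise; ignores trailing zeros)
_≈P_ : Poly → Poly → Set
p ≈P q = ∀ i → coeff p i ≡ coeff q i

_∣P_ : Poly → Poly → Set
p ∣P q = ∃ λ r → mulP p r ≈P q

NonConstant : Poly → Set
NonConstant p = ∃ λ i → coeff p (suc i) ≡ true

Irreducible : Poly → Set
Irreducible c = NonConstant c × ¬ (∃ λ f → ∃ λ g → NonConstant f × NonConstant g × mulP f g ≈P c)

xPowPlusOne : ℕ → Poly
xPowPlusOne e = addP (replicate e false ++ (true ∷ [])) (true ∷ [])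

-- primitive of degree n: irreducible, and its root x (in GF(2)[x]/(c)) has
-- multiplicative order exactly 2^n - 1, i.e. 2^n - 1 is the least e ≥ 1
-- with x^e ≡ 1 (mod c).
Primitive : ℕ → Poly → Set
Primitive n c =
  Irreducible c ×
  (c ∣P xPowPlusOne (2 ^ n ∸ 1)) ×
  (∀ e → 1 ≤ e → e < 2 ^ n ∸ 1 → ¬ (c ∣P xPowPlusOne e))

xorSum : ∀ {m} → Vec Bool m → Bool
xorSum = Vec.foldr _ _xor_ false

-- state (s_k, …, s_{k+n-1}); the new value s_{k+n} = b + Σ_{j<n} c_{n-j} s_{k+j}
feedback : (n : ℕ) → Poly → Bool → Vec Bool n → Bool
feedback n c b s = b xor xorSum (zipWith _∧_ (tabulate (λ j → coeff c (n ∸ toℕ j))) s)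

shiftIn : ∀ {m} → Vec Bool m → Bool → Vec Bool m
shiftIn Vec.[]        _ = Vec.[]
shiftIn (x Vec.∷ xs)  b = xs ∷ʳ b

state : (n : ℕ) → Poly → Bool → Vec Bool n → ℕ → Vec Bool n
state n c b init zero    = init
state n c b init (suc k) = let s = state n c b init k in shiftIn s (feedback n c b s)

headOr0 : ∀ {m} → Vec Bool m → Bool
headOr0 Vec.[]       = false
headOr0 (x Vec.∷ _)  = x

lfsr : (n : ℕ) → Poly → Bool → Vec Bool n → ℕ → Bool
lfsr n c b init k = headOr0 (state n c b init k)

record CycSeq : Set where
  constructor cyc
  field
    predLen : ℕ
    elem    : Fin (suc predLen) → Bool

open CycSeq public

window : (s : CycSeq) (N : ℕ) → Fin (suc (predLen s)) → Vec Bool N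
window s N i = tabulate (λ j → elem s ((toℕ i + toℕ j) mod suc (predLen s)))

count : ∀ {m} → Vec Bool m → ℕ
count = Vec.foldr _ (λ b n → if b then suc n else n) 0

hamming : ∀ {m} → Vec Bool m → Vec Bool m → ℕ
hamming x y = count (zipWith _xor_ x y)

CoveringSeqCode : ℕ → ℕ → List CycSeq → Set
CoveringSeqCode N R code =
  ∀ (x : Vec Bool N) → ∃ λ s → s ∈ code × ∃ λ i → hamming x (window s N i) ≤ R

-- one period (length 2^n - 1) of the sequence generated by the recurrence
periodSeq : (n : ℕ) → Poly → Bool → Vec Bool n → CycSeq
periodSeq n c b init = cyc (2 ^ n ∸ 2) (λ i → lfsr n c b init (toℕ i))

zeroSeq oneSeq : CycSeq
zeroSeq = cyc 0 (λ _ → false)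
oneSeq  = cyc 0 (λ _ → true)

-- Write a word x of length n + 2R + 1 as u followed by y, where u has length n. Because
-- c₁ = ⋯ = c₂ᵣ₊₁ = 0, every sequence of either recurrence that passes through the state u
-- continues with the same 2R + 1 bits ℓ(u) (for 𝒜) or their complements (for ℬ), and by a
-- majority count y is within distance R of one of the two. It remains to meet u as a state:
-- 𝒜 is an m-sequence and runs through every nonzero state within one period, since a shorter
-- period d of the impulse response would make c divide xᵈ + 1; ℬ is the complement of such a
-- sequence, because c(1) = 1 (otherwise the all-one state would be fixed); and the states
-- 0 and 1 are covered by [0] and [1].

module Submission where

open import Algebra.Bundles using (CommutativeRing)
open import Data.Bool using (Bool; true; false; not; _xor_; _∧_; if_then_else_)
import Data.Bool as Bool
open import Data.Bool.Properties
  using (xor-∧-commutativeRing; xor-comm; xor-assoc; xor-same; xor-identityʳ; ∧-zeroʳ; ∧-distribˡ-xor;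
         not-injective; not-involutive; not-distribʳ-xor)
open import Data.List using (List; []; _∷_; length; _++_)
open import Data.List.Relation.Unary.Any using (here; there)
open import Data.List.Membership.Propositional using (_∈_)
import Data.List as List
open import Data.Nat using (ℕ; zero; suc; _+_; _*_; _∸_; _^_; _≤_; _<_; z≤n; s≤s; z<s; s<s; s≤s⁻¹; s<s⁻¹; NonZero)
open import Data.Nat.Properties
open import Data.Nat.DivMod using (_mod_; _%_; _/_; m≡m%n+[m/n]*n; m%n<n)
open import Data.Product using (∃; ∃₂; _×_; _,_; uncurry)
open import Data.Sum using (_⊎_; inj₁; inj₂)
open import Data.Vec using (Vec; []; _∷_; tabulate; zipWith; _∷ʳ_; replicate; map; lookup)
open import Data.Vec.Properties
  using (≡-dec; ∷ʳ-injective; tabulate∘lookup; tabulate-cong; map-∷ʳ; map-∘; map-cong; map-id; map-replicate)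
open import Data.Fin using (Fin; zero; suc; toℕ; funToFin; finToFun)
open import Data.Fin.Properties using (2↔Bool; finToFun-funToFin; pigeonhole; toℕ<n; toℕ-injective; toℕ-fromℕ<)
open import Function.Bundles using (Inverse)
open import Function using (_∘_)
open import Relation.Binary.PropositionalEquality
open import Relation.Nullary using (¬_; yes; no; contradiction)
open import Relation.Binary.Definitions using (tri<; tri≈; tri>)
open import Data.Nat.Tactic.RingSolver using (solve-∀)

open import Defs

open import Algebra.Properties.CommutativeSemigroup
  (CommutativeRing.+-commutativeSemigroup xor-∧-commutativeRing) using (interchange)

xor-cancelˡ : ∀ a {b c} → a xor b ≡ a xor c → b ≡ c
xor-cancelˡ false eq = eq
xor-cancelˡ true  eq = not-injective eq

xor-cancelʳ : ∀ a {b c} → b xor a ≡ c xor a → b ≡ c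
xor-cancelʳ a {b} {c} eq = xor-cancelˡ a (trans (xor-comm a b) (trans eq (xor-comm c a)))

xor-xor-same : ∀ a b → (a xor b) xor b ≡ a
xor-xor-same a b = trans (xor-assoc a b b) (trans (cong (a xor_) (xor-same b)) (xor-identityʳ a))

xor-moveʳ : ∀ a b {c} → a xor b ≡ c → a ≡ c xor b
xor-moveʳ a b refl = sym (xor-xor-same a b)

xorSum< : ℕ → (ℕ → Bool) → Bool
xorSum< zero    f = false
xorSum< (suc m) f = f 0 xor xorSum< m (f ∘ suc)

xorSum<-cong : ∀ m {f g} → (∀ i → i < m → f i ≡ g i) → xorSum< m f ≡ xorSum< m g
xorSum<-cong zero    eq = refl
xorSum<-cong (suc m) eq = cong₂ _xor_ (eq 0 z<s) (xorSum<-cong m (λ i i<m → eq (suc i) (s<s i<m)))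

xorSum<-false : ∀ m {f} → (∀ i → i < m → f i ≡ false) → xorSum< m f ≡ false
xorSum<-false zero    eq = refl
xorSum<-false (suc m) eq rewrite eq 0 z<s = xorSum<-false m (λ i i<m → eq (suc i) (s<s i<m))

xorSum<-+ : ∀ a b f → xorSum< (a + b) f ≡ xorSum< a f xor xorSum< b (λ i → f (a + i))
xorSum<-+ zero    b f = refl
xorSum<-+ (suc a) b f =
  trans (cong (f 0 xor_) (xorSum<-+ a b (f ∘ suc))) (sym (xor-assoc (f 0) _ _))

xorSum<-truncate : ∀ a b {f} → (∀ i → a ≤ i → f i ≡ false) → xorSum< (a + b) f ≡ xorSum< a f
xorSum<-truncate a b {f} eq = begin
  xorSum< (a + b) f                                  ≡⟨ xorSum<-+ a b f ⟩
  xorSum< a f xor xorSum< b (λ i → f (a + i))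
    ≡⟨ cong (xorSum< a f xor_) (xorSum<-false b (λ i _ → eq (a + i) (m≤m+n a i))) ⟩
  xorSum< a f xor false                              ≡⟨ xor-identityʳ _ ⟩
  xorSum< a f                                        ∎
  where open ≡-Reasoning

xorSum<-suc : ∀ m f → xorSum< (suc m) f ≡ xorSum< m f xor f m
xorSum<-suc zero    f = xor-comm (f 0) false
xorSum<-suc (suc m) f =
  trans (cong (f 0 xor_) (xorSum<-suc m (f ∘ suc))) (sym (xor-assoc (f 0) _ _))

xorSum<-reverse : ∀ m f → xorSum< m f ≡ xorSum< m (λ j → f (m ∸ suc j))
xorSum<-reverse zero    f = refl
xorSum<-reverse (suc m) f =
  trans (xorSum<-suc m f) (trans (xor-comm _ (f m)) (cong (f m xor_) (xorSum<-reverse m f)))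

xorSum<-xor : ∀ m f g → xorSum< m (λ i → f i xor g i) ≡ xorSum< m f xor xorSum< m g
xorSum<-xor zero    f g = refl
xorSum<-xor (suc m) f g =
  trans (cong ((f 0 xor g 0) xor_) (xorSum<-xor m (f ∘ suc) (g ∘ suc))) (interchange (f 0) (g 0) _ _)

count< : ℕ → (ℕ → Bool) → ℕ
count< zero    f = 0
count< (suc m) f = if f 0 then suc (count< m (f ∘ suc)) else count< m (f ∘ suc)

count<-cong : ∀ m {f g} → (∀ i → i < m → f i ≡ g i) → count< m f ≡ count< m g
count<-cong zero    eq = refl
count<-cong (suc m) {f} {g} eq
  rewrite eq 0 z<s | count<-cong m {f ∘ suc} {g ∘ suc} (λ i i<m → eq (suc i) (s<s i<m)) = refl

count<-false : ∀ m {f} → (∀ i → i < m → f i ≡ false) → count< m f ≡ 0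
count<-false zero    eq = refl
count<-false (suc m) eq rewrite eq 0 z<s = count<-false m (λ i i<m → eq (suc i) (s<s i<m))

count<-+ : ∀ a b f → count< (a + b) f ≡ count< a f + count< b (λ i → f (a + i))
count<-+ zero    b f = refl
count<-+ (suc a) b f with f 0
... | true  = cong suc (count<-+ a b (f ∘ suc))
... | false = count<-+ a b (f ∘ suc)

count<-not : ∀ m f → count< m f + count< m (not ∘ f) ≡ m
count<-not zero    f = refl
count<-not (suc m) f with f 0
... | true  = cong suc (count<-not m (f ∘ suc))
... | false = trans (+-suc _ _) (cong suc (count<-not m (f ∘ suc)))

majority : ∀ R f → count< (2 * R + 1) f ≤ R ⊎ count< (2 * R + 1) (not ∘ f) ≤ R
majority R f with count< (2 * R + 1) f ≤? R | count< (2 * R + 1) (not ∘ f) ≤? R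
... | yes close | _         = inj₁ close
... | no _      | yes close = inj₂ close
... | no far    | no far′   = contradiction (count<-not (2 * R + 1) f) (>⇒≢ too-many)
  where
  double-suc : ∀ r → suc (2 * r + 1) ≡ suc r + suc r
  double-suc = solve-∀
  too-many : 2 * R + 1 < count< (2 * R + 1) f + count< (2 * R + 1) (not ∘ f)
  too-many = ≤-trans (≤-reflexive (double-suc R)) (+-mono-≤ (≰⇒> far) (≰⇒> far′))

at : ∀ {m} → Vec Bool m → ℕ → Bool
at []      _       = false
at (a ∷ v) zero    = a
at (a ∷ v) (suc j) = at v j

at-tabulate : ∀ {m} (f : ℕ → Bool) j → j < m → at (tabulate {n = m} (f ∘ toℕ)) j ≡ f j
at-tabulate {suc m} f zero    _         = refl
at-tabulate {suc m} f (suc j) (s<s j<m) = at-tabulate (f ∘ suc) j j<m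

at-∷ʳ : ∀ {m} (v : Vec Bool m) b j → j < m → at (v ∷ʳ b) j ≡ at v j
at-∷ʳ (a ∷ v) b zero    _         = refl
at-∷ʳ (a ∷ v) b (suc j) (s<s j<m) = at-∷ʳ v b j j<m

at-∷ʳ-last : ∀ {m} (v : Vec Bool m) b → at (v ∷ʳ b) m ≡ b
at-∷ʳ-last []      b = refl
at-∷ʳ-last (a ∷ v) b = at-∷ʳ-last v b

at-replicate : ∀ m a j → j < m → at (replicate m a) j ≡ a
at-replicate (suc m) a zero    _         = refl
at-replicate (suc m) a (suc j) (s<s j<m) = at-replicate m a j j<m

at-map : ∀ {m} f (v : Vec Bool m) j → j < m → at (map f v) j ≡ f (at v j)
at-map f (a ∷ v) zero    _         = refl
at-map f (a ∷ v) (suc j) (s<s j<m) = at-map f v j j<m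

hamming-tabulate : ∀ {m} (x : Vec Bool m) (f : ℕ → Bool) →
                   hamming x (tabulate (f ∘ toℕ)) ≡ count< m (λ j → at x j xor f j)
hamming-tabulate []      f = refl
hamming-tabulate (a ∷ x) f =
  cong (λ r → if a xor f 0 then suc r else r) (hamming-tabulate x (f ∘ suc))

replicate-∷ʳ : ∀ m (a : Bool) → replicate m a ∷ʳ a ≡ replicate (suc m) a
replicate-∷ʳ zero    a = refl
replicate-∷ʳ (suc m) a = cong (a ∷_) (replicate-∷ʳ m a)

xorSum-tabulate : ∀ {m} (f : ℕ → Bool) (v : Vec Bool m) →
                  xorSum (zipWith _∧_ (tabulate (f ∘ toℕ)) v) ≡ xorSum< m (λ j → f j ∧ at v j)
xorSum-tabulate f []      = refl
xorSum-tabulate f (a ∷ v) = cong ((f 0 ∧ a) xor_) (xorSum-tabulate (f ∘ suc) v)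

coeff-≥length : ∀ p i → length p ≤ i → coeff p i ≡ false
coeff-≥length []      i       _         = refl
coeff-≥length (a ∷ p) (suc i) (s≤s p≤i) = coeff-≥length p i p≤i

coeff-addP : ∀ p q i → coeff (addP p q) i ≡ coeff p i xor coeff q i
coeff-addP []      q       i       = refl
coeff-addP (a ∷ p) []      i       = sym (xor-identityʳ _)
coeff-addP (a ∷ p) (b ∷ q) zero    = refl
coeff-addP (a ∷ p) (b ∷ q) (suc i) = coeff-addP p q i

conv : Poly → (ℕ → Bool) → ℕ → Bool
conv c s m = xorSum< (suc m) (λ i → coeff c i ∧ s (m ∸ i))

coeff-mulP : ∀ p q m → coeff (mulP p q) m ≡ conv p (coeff q) m
coeff-mulP []      q m = sym (xorSum<-false (suc m) (λ _ _ → refl))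
coeff-mulP (a ∷ p) q m =
  trans (coeff-addP (if a then q else []) (false ∷ mulP p q) m) (cong₂ _xor_ (scaled a) (shifted m))
  where
  scaled : ∀ a → coeff (if a then q else []) m ≡ a ∧ coeff q m
  scaled true  = refl
  scaled false = refl
  shifted : ∀ m → coeff (false ∷ mulP p q) m ≡ xorSum< m (λ i → coeff p i ∧ coeff q (m ∸ suc i))
  shifted zero    = refl
  shifted (suc m) = coeff-mulP p q m

conv-cong : ∀ c {s t} → (∀ k → s k ≡ t k) → ∀ m → conv c s m ≡ conv c t m
conv-cong c eq m = xorSum<-cong (suc m) (λ i _ → cong (coeff c i ∧_) (eq (m ∸ i)))

conv-xor : ∀ c s t m → conv c (λ k → s k xor t k) m ≡ conv c s m xor conv c t m
conv-xor c s t m = trans (xorSum<-cong (suc m) (λ i _ → ∧-distribˡ-xor (coeff c i) (s (m ∸ i)) (t (m ∸ i))))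
                         (xorSum<-xor (suc m) (λ i → coeff c i ∧ s (m ∸ i)) (λ i → coeff c i ∧ t (m ∸ i)))

-- multiplication of a power series by xᵈ
delay : ℕ → (ℕ → Bool) → ℕ → Bool
delay zero    s k       = s k
delay (suc d) s zero    = false
delay (suc d) s (suc k) = delay d s k

delay-cong : ∀ d {s t} → (∀ k → s k ≡ t k) → ∀ k → delay d s k ≡ delay d t k
delay-cong zero    eq k       = eq k
delay-cong (suc d) eq zero    = refl
delay-cong (suc d) eq (suc k) = delay-cong d eq k

conv-step : ∀ c s m → s 0 ≡ false → conv c s (suc m) ≡ conv c (s ∘ suc) m
conv-step c s m s₀ = begin
  xorSum< (suc (suc m)) f          ≡⟨ xorSum<-suc (suc m) f ⟩
  xorSum< (suc m) f xor f (suc m)  ≡⟨ cong₂ _xor_ (xorSum<-cong (suc m) shift) last-term ⟩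
  conv c (s ∘ suc) m xor false     ≡⟨ xor-identityʳ _ ⟩
  conv c (s ∘ suc) m               ∎
  where
  open ≡-Reasoning
  f : ℕ → Bool
  f i = coeff c i ∧ s (suc m ∸ i)
  shift : ∀ i → i < suc m → f i ≡ coeff c i ∧ s (suc (m ∸ i))
  shift i i<1+m = cong (λ k → coeff c i ∧ s k) (+-∸-assoc 1 (s≤s⁻¹ i<1+m))
  last-term : f (suc m) ≡ false
  last-term = trans (cong (λ k → coeff c (suc m) ∧ s k) (n∸n≡0 m))
                    (trans (cong (coeff c (suc m) ∧_) s₀) (∧-zeroʳ _))

conv-delay : ∀ c d s m → conv c (delay d s) m ≡ delay d (conv c s) m
conv-delay c zero    s m       = refl
conv-delay c (suc d) s zero    = cong (_xor false) (∧-zeroʳ (coeff c 0))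
conv-delay c (suc d) s (suc m) = trans (conv-step c (delay (suc d) s) m refl) (conv-delay c d s m)

conv-drop : ∀ c d s m → (∀ k → k < d → s k ≡ false) → conv c s (d + m) ≡ conv c (λ k → s (d + k)) m
conv-drop c zero    s m _     = refl
conv-drop c (suc d) s m s<d≡0 = trans (conv-step c s (d + m) (s<d≡0 0 z<s))
  (conv-drop c d (s ∘ suc) m (λ k k<d → s<d≡0 (suc k) (s<s k<d)))

coeff-replicate-++ : ∀ d p k → coeff (List.replicate d false ++ p) k ≡ delay d (coeff p) k
coeff-replicate-++ zero    p k       = refl
coeff-replicate-++ (suc d) p zero    = refl
coeff-replicate-++ (suc d) p (suc k) = coeff-replicate-++ d p k

prefix : (ℕ → Bool) → ℕ → Poly
prefix s zero    = []
prefix s (suc d) = s 0 ∷ prefix (s ∘ suc) d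

prefix-xor-delay : ∀ d s k → coeff (prefix s d) k xor delay d (λ r → s (d + r)) k ≡ s k
prefix-xor-delay zero    s k       = refl
prefix-xor-delay (suc d) s zero    = xor-identityʳ (s 0)
prefix-xor-delay (suc d) s (suc k) = prefix-xor-delay d (s ∘ suc) k

one : Poly
one = true ∷ []

inverse-periodic⇒∣P : ∀ c s d → (∀ m → conv c s m ≡ coeff one m) → (∀ k → s (d + k) ≡ s k) →
                      c ∣P xPowPlusOne d
inverse-periodic⇒∣P c s d inverse periodic = prefix s d , λ m → begin
  coeff (mulP c (prefix s d)) m                    ≡⟨ coeff-mulP c (prefix s d) m ⟩
  conv c (coeff (prefix s d)) m                    ≡⟨ conv-cong c prefix≡ m ⟩
  conv c (λ k → s k xor delay d s k) m             ≡⟨ conv-xor c s (delay d s) m ⟩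
  conv c s m xor conv c (delay d s) m              ≡⟨ cong (conv c s m xor_) (conv-delay c d s m) ⟩
  conv c s m xor delay d (conv c s) m              ≡⟨ cong₂ _xor_ (inverse m) (delay-cong d inverse m) ⟩
  coeff one m xor delay d (coeff one) m            ≡⟨ xor-comm (coeff one m) _ ⟩
  delay d (coeff one) m xor coeff one m            ≡⟨ cong (_xor coeff one m) (coeff-replicate-++ d one m) ⟨
  coeff (List.replicate d false ++ one) m xor coeff one m ≡⟨ coeff-addP (List.replicate d false ++ one) one m ⟨
  coeff (xPowPlusOne d) m                          ∎
  where
  open ≡-Reasoning
  prefix≡ : ∀ k → coeff (prefix s d) k ≡ s k xor delay d s k
  prefix≡ k = xor-moveʳ _ _ (trans (cong (coeff (prefix s d) k xor_) (delay-cong d (sym ∘ periodic) k))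
                                   (prefix-xor-delay d s k))

periodic-% : ∀ {A : Set} (f : ℕ → A) d .{{_ : NonZero d}} → (∀ k → f (k + d) ≡ f k) → ∀ k → f (k % d) ≡ f k
periodic-% f d periodic k = trans (sym (periodic-* (k % d) (k / d))) (cong f (sym (m≡m%n+[m/n]*n k d)))
  where
  periodic-* : ∀ k q → f (k + q * d) ≡ f k
  periodic-* k zero    = cong f (+-identityʳ k)
  periodic-* k (suc q) = trans (cong f (trans (cong (k +_) (+-comm d (q * d))) (sym (+-assoc k (q * d) d))))
                               (trans (periodic (k + q * d)) (periodic-* k q))

encode : ∀ {m} → Vec Bool m → Fin (2 ^ m)
encode v = funToFin (Inverse.from 2↔Bool ∘ lookup v)

encode-injective : ∀ {m} {u v : Vec Bool m} → encode u ≡ encode v → u ≡ v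
encode-injective {u = u} {v} eq = begin
  u                   ≡⟨ tabulate∘lookup u ⟨
  tabulate (lookup u) ≡⟨ tabulate-cong same-entries ⟩
  tabulate (lookup v) ≡⟨ tabulate∘lookup v ⟩
  v                   ∎
  where
  open ≡-Reasoning
  open Inverse 2↔Bool using (to; from; strictlyInverseˡ)
  same-entries : ∀ i → lookup u i ≡ lookup v i
  same-entries i = begin
    lookup u i             ≡⟨ strictlyInverseˡ (lookup u i) ⟨
    to (from (lookup u i)) ≡⟨ cong to (finToFun-funToFin _ i) ⟨
    to (finToFun (encode u) i) ≡⟨ cong (λ k → to (finToFun k i)) eq ⟩
    to (finToFun (encode v) i) ≡⟨ cong to (finToFun-funToFin _ i) ⟩
    to (from (lookup v i)) ≡⟨ strictlyInverseˡ (lookup v i) ⟩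
    lookup v i             ∎

injective⇒onto : ∀ {N m} → N ≡ 2 ^ m → (h : Fin N → Vec Bool m) → (∀ {i j} → h i ≡ h j → i ≡ j) →
                 ∀ v → ∃ λ i → h i ≡ v
injective⇒onto refl h injective v = collision (pigeonhole (n<1+n _) (encode ∘ h⁺))
  where
  h⁺ : Fin (suc _) → Vec Bool _
  h⁺ zero    = v
  h⁺ (suc i) = h i
  collision : (∃₂ λ i j → toℕ i < toℕ j × encode (h⁺ i) ≡ encode (h⁺ j)) → ∃ λ i → h i ≡ v
  collision (zero  , suc j , _   , eq) = j , sym (encode-injective eq)
  collision (suc i , suc j , i<j , eq) =
    contradiction (cong toℕ (injective (encode-injective eq))) (<⇒≢ (s<s⁻¹ i<j))

module LFSR (n′ : ℕ) (c : Poly) where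

  n : ℕ
  n = suc n′

  tap : ℕ → Bool
  tap j = coeff c (n ∸ j)

  -- 2ⁿ − 1, in the form of the length of periodSeq
  period : ℕ
  period = suc (2 ^ n ∸ 2)

  step : Bool → Vec Bool n → Vec Bool n
  step b v = shiftIn v (feedback n c b v)

  feedback-xorSum< : ∀ b v → feedback n c b v ≡ b xor xorSum< n (λ j → tap j ∧ at v j)
  feedback-xorSum< b v = cong (b xor_) (xorSum-tabulate tap v)

  at-shiftIn : ∀ (v : Vec Bool n) a j → suc j < n → at (shiftIn v a) j ≡ at v (suc j)
  at-shiftIn (x ∷ v) a j (s<s j<n′) = at-∷ʳ v a j j<n′

  at-zero : ∀ (v : Vec Bool n) → at v 0 ≡ headOr0 v
  at-zero (x ∷ v) = refl

  at-state : ∀ b v k j → j < n → at (state n c b v k) j ≡ lfsr n c b v (k + j)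
  at-state b v k zero    _   =
    trans (at-zero (state n c b v k)) (cong (lfsr n c b v) (sym (+-identityʳ k)))
  at-state b v k (suc j) j<n = begin
    at (state n c b v k) (suc j)      ≡⟨ at-shiftIn (state n c b v k) _ j j<n ⟨
    at (state n c b v (suc k)) j      ≡⟨ at-state b v (suc k) j (<-trans (n<1+n j) j<n) ⟩
    lfsr n c b v (suc k + j)          ≡⟨ cong (lfsr n c b v) (+-suc k j) ⟨
    lfsr n c b v (k + suc j)          ∎
    where open ≡-Reasoning

  lfsr-feedback : ∀ b v k → lfsr n c b v (k + n) ≡ feedback n c b (state n c b v k)
  lfsr-feedback b v k = begin
    lfsr n c b v (k + n)              ≡⟨ cong (lfsr n c b v) (+-suc k n′) ⟩
    lfsr n c b v (suc k + n′)         ≡⟨ at-state b v (suc k) n′ ≤-refl ⟨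
    at (step b (state n c b v k)) n′  ≡⟨ at-last (state n c b v k) ⟩
    feedback n c b (state n c b v k) ∎
    where
    open ≡-Reasoning
    at-last : ∀ (w : Vec Bool n) → at (step b w) n′ ≡ feedback n c b w
    at-last (x ∷ w) = at-∷ʳ-last w _

  lfsr-recurrence : ∀ b v k →
                    lfsr n c b v (k + n) ≡ b xor xorSum< n (λ j → tap j ∧ lfsr n c b v (k + j))
  lfsr-recurrence b v k =
    trans (lfsr-feedback b v k) (trans (feedback-xorSum< b (state n c b v k))
      (cong (b xor_) (xorSum<-cong n (λ j j<n → cong (tap j ∧_) (at-state b v k j j<n)))))

  state-+ : ∀ b v j k → state n c b (state n c b v j) k ≡ state n c b v (k + j)
  state-+ b v j zero    = refl
  state-+ b v j (suc k) = cong (step b) (state-+ b v j k)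

  state-periodic : ∀ b v d → state n c b v d ≡ v → ∀ k → state n c b v (k + d) ≡ state n c b v k
  state-periodic b v d returns k =
    trans (sym (state-+ b v d k)) (cong (λ w → state n c b w k) returns)

  step-injective : coeff c n ≡ true → ∀ b {v w} → step b v ≡ step b w → v ≡ w
  step-injective cₙ b {x ∷ v} {y ∷ w} eq with ∷ʳ-injective v w eq
  ... | refl , same-feedback = cong (_∷ v) (xor-cancelʳ rest
          (subst (λ k → (k ∧ x) xor rest ≡ (k ∧ y) xor rest) cₙ (xor-cancelˡ b same-feedback)))
    where
    rest : Bool
    rest = xorSum (zipWith _∧_ (tabulate (λ j → tap (suc (toℕ j)))) v)

  state-injective : coeff c n ≡ true → ∀ b {v w} k → state n c b v k ≡ state n c b w k → v ≡ w
  state-injective cₙ b zero    eq = eq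
  state-injective cₙ b (suc k) eq = state-injective cₙ b k (step-injective cₙ b eq)

  state-return : coeff c n ≡ true → ∀ b v d j →
                 state n c b v (j + d) ≡ state n c b v j → state n c b v d ≡ v
  state-return cₙ b v d j eq = state-injective cₙ b j (trans (state-+ b v d j) eq)

  constant-state : ∀ b → feedback n c b (replicate n b) ≡ b →
                   ∀ k → state n c b (replicate n b) k ≡ replicate n b
  constant-state b fixed zero    = refl
  constant-state b fixed (suc k) = trans (cong (step b) (constant-state b fixed k))
    (trans (cong (shiftIn (replicate n b)) fixed) (replicate-∷ʳ n′ b))

  conv-lfsr : coeff c 0 ≡ true → length c ≡ n + 1 → ∀ b v k → conv c (lfsr n c b v) (k + n) ≡ b
  conv-lfsr c₀ len b v k = begin
    xorSum< (suc (k + n)) g                   ≡⟨ cong (λ m → xorSum< (suc m) g) (+-comm k n) ⟩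
    xorSum< (suc n + k) g                     ≡⟨ xorSum<-truncate (suc n) k high-terms ⟩
    g 0 xor xorSum< n (g ∘ suc)
      ≡⟨ cong₂ _xor_ (cong (_∧ s (k + n)) c₀) (xorSum<-reverse n (g ∘ suc)) ⟩
    s (k + n) xor xorSum< n (λ j → g (suc (n ∸ suc j)))
      ≡⟨ cong (s (k + n) xor_) (xorSum<-cong n reindex) ⟩
    s (k + n) xor X                           ≡⟨ cong (_xor X) (lfsr-recurrence b v k) ⟩
    (b xor X) xor X                           ≡⟨ xor-xor-same b X ⟩
    b                                         ∎
    where
    open ≡-Reasoning
    s : ℕ → Bool
    s = lfsr n c b v
    g : ℕ → Bool
    g i = coeff c i ∧ s (k + n ∸ i)
    X : Bool
    X = xorSum< n (λ j → tap j ∧ s (k + j))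
    high-terms : ∀ i → suc n ≤ i → g i ≡ false
    high-terms i n<i =
      cong (_∧ s (k + n ∸ i)) (coeff-≥length c i (subst (_≤ i) (sym (trans len (+-comm n 1))) n<i))
    reindex : ∀ j → j < n → g (suc (n ∸ suc j)) ≡ tap j ∧ s (k + j)
    reindex j j<n = trans (cong g (sym (+-∸-assoc 1 j<n)))
      (cong (λ m → tap j ∧ s m) (trans (+-∸-assoc k (m∸n≤m n j)) (cong (k +_) (m∸[m∸n]≡n (<⇒≤ j<n)))))

module MaximalPeriod (n′ : ℕ) (c : Poly) (c₀ : coeff c 0 ≡ true) (cₙ : coeff c (suc n′) ≡ true)
                     (len : length c ≡ suc n′ + 1) (1≤n′ : 1 ≤ n′)
                     (order : ∀ e → 1 ≤ e → e < 2 ^ suc n′ ∸ 1 → ¬ (c ∣P xPowPlusOne e)) where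

  open LFSR n′ c

  2≤2^n : 2 ≤ 2 ^ n
  2≤2^n = *-monoʳ-≤ 2 (m^n>0 2 n′)

  period≡2^n∸1 : period ≡ 2 ^ n ∸ 1
  period≡2^n∸1 = sym (+-∸-assoc 1 2≤2^n)

  1+period≡2^n : suc period ≡ 2 ^ n
  1+period≡2^n = m+[n∸m]≡n 2≤2^n

  1<period : 1 < period
  1<period = s≤s (≤-trans (s≤s z≤n) (∸-monoˡ-≤ {2 ^ 2} {2 ^ n} 2 (^-monoʳ-≤ 2 (s≤s 1≤n′))))

  zeros ones : Vec Bool n
  zeros = replicate n false
  ones  = replicate n true

  state-zeros : ∀ k → state n c false zeros k ≡ zeros
  state-zeros = constant-state false (trans (feedback-xorSum< false zeros) (xorSum<-false n
    (λ j j<n → trans (cong (tap j ∧_) (at-replicate n false j j<n)) (∧-zeroʳ (tap j)))))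

  state-nonzero : ∀ {v} k → v ≢ zeros → state n c false v k ≢ zeros
  state-nonzero k v≢0 eq = v≢0 (state-injective cₙ false k (trans eq (sym (state-zeros k))))

  impulse : Vec Bool n
  impulse = replicate n′ false ∷ʳ true

  response : ℕ → Bool
  response = lfsr n c false impulse

  response-silent : ∀ k → k < n′ → response k ≡ false
  response-silent k k<n′ = begin
    response k                          ≡⟨ at-state false impulse 0 k (m<n⇒m<1+n k<n′) ⟨
    at impulse k                        ≡⟨ at-∷ʳ (replicate n′ false) true k k<n′ ⟩
    at (replicate n′ false) k           ≡⟨ at-replicate n′ false k k<n′ ⟩
    false                               ∎
    where open ≡-Reasoning

  response-first : response n′ ≡ true
  response-first = trans (sym (at-state false impulse 0 n′ ≤-refl)) (at-∷ʳ-last (replicate n′ false) true)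

  impulse-nonzero : impulse ≢ zeros
  impulse-nonzero eq = contradiction
    (trans (sym (at-∷ʳ-last (replicate n′ false) true)) (trans (cong (λ v → at v n′) eq) (at-replicate n false n′ ≤-refl)))
    λ ()

  -- The impulse response read from index n′ on is the power-series inverse of c, so a period d
  -- of it would make c divide xᵈ + 1.
  base : Vec Bool n
  base = state n c false impulse n′

  base-inverse : ∀ m → conv c (lfsr n c false base) m ≡ coeff one m
  base-inverse m = trans (conv-cong c shifted m) (delayed-inverse m)
    where
    open ≡-Reasoning
    shifted : ∀ k → lfsr n c false base k ≡ response (n′ + k)
    shifted k = trans (cong headOr0 (state-+ false impulse n′ k)) (cong response (+-comm k n′))
    delayed-inverse : ∀ m → conv c (λ k → response (n′ + k)) m ≡ coeff one m
    delayed-inverse zero    =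
      cong₂ (λ a r → (a ∧ r) xor false) c₀ (trans (cong response (+-identityʳ n′)) response-first)
    delayed-inverse (suc m) = begin
      conv c (λ k → response (n′ + k)) (suc m) ≡⟨ conv-drop c n′ response (suc m) response-silent ⟨
      conv c response (n′ + suc m)             ≡⟨ cong (conv c response) (trans (+-suc n′ m) (+-comm n m)) ⟩
      conv c response (m + n)                  ≡⟨ conv-lfsr c₀ len false impulse m ⟩
      false                                    ∎

  base-nonzero : base ≢ zeros
  base-nonzero = state-nonzero n′ impulse-nonzero

  no-short-period : ∀ d → 1 ≤ d → d < period → state n c false base d ≢ base
  no-short-period d 1≤d d<period returns = order d 1≤d (subst (d <_) period≡2^n∸1 d<period)
    (inverse-periodic⇒∣P c (lfsr n c false base) d base-inverse
      λ k → trans (cong (lfsr n c false base) (+-comm d k)) (cong headOr0 (state-periodic false base d returns k)))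

  orbit-distinct : ∀ {i j} → i < j → j ∸ i < period → state n c false base i ≢ state n c false base j
  orbit-distinct {i} {j} i<j short eq = no-short-period (j ∸ i) (m<n⇒0<n∸m i<j) short
    (state-return cₙ false base (j ∸ i) i
      (trans (cong (state n c false base) (m+[n∸m]≡n (<⇒≤ i<j))) (sym eq)))

  orbit : Fin (suc period) → Vec Bool n
  orbit zero    = zeros
  orbit (suc i) = state n c false base (toℕ i)

  orbit-injective : ∀ {i j} → orbit i ≡ orbit j → i ≡ j
  orbit-injective {zero}  {zero}  _  = refl
  orbit-injective {zero}  {suc j} eq = contradiction (sym eq) (state-nonzero (toℕ j) base-nonzero)
  orbit-injective {suc i} {zero}  eq = contradiction eq (state-nonzero (toℕ i) base-nonzero)
  orbit-injective {suc i} {suc j} eq with <-cmp (toℕ i) (toℕ j)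
  ... | tri< i<j _ _ = contradiction eq (orbit-distinct i<j (≤-<-trans (m∸n≤m (toℕ j) (toℕ i)) (toℕ<n j)))
  ... | tri≈ _ i≡j _ = cong suc (toℕ-injective i≡j)
  ... | tri> _ _ j<i = contradiction (sym eq) (orbit-distinct j<i (≤-<-trans (m∸n≤m (toℕ i) (toℕ j)) (toℕ<n i)))

  base-reaches : ∀ v → v ≢ zeros → ∃ λ k → k < period × state n c false base k ≡ v
  base-reaches v v≢0 with injective⇒onto 1+period≡2^n orbit orbit-injective v
  ... | zero  , eq = contradiction (sym eq) v≢0
  ... | suc k , eq = toℕ k , toℕ<n k , eq

  base-period : state n c false base period ≡ base
  base-period with base-reaches (state n c false base period) (state-nonzero period base-nonzero)
  ... | zero  , _         , eq = sym eq
  ... | suc k , 1+k<period , eq =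
    contradiction eq (orbit-distinct 1+k<period (∸-monoʳ-< z<s (<⇒≤ 1+k<period)))

  base-periodic : ∀ k → state n c false base (k + period) ≡ state n c false base k
  base-periodic = state-periodic false base period base-period

  nonzero-period : ∀ a → a ≢ zeros → state n c false a period ≡ a
  nonzero-period a a≢0 with base-reaches a a≢0
  ... | j , _ , refl = begin
    state n c false (state n c false base j) period ≡⟨ state-+ false base j period ⟩
    state n c false base (period + j)               ≡⟨ cong (state n c false base) (+-comm period j) ⟩
    state n c false base (j + period)               ≡⟨ base-periodic j ⟩
    state n c false base j                          ∎
    where open ≡-Reasoning

  nonzero-reaches : ∀ a v → a ≢ zeros → v ≢ zeros → ∃ λ k → state n c false a k ≡ v
  nonzero-reaches a v a≢0 v≢0 with base-reaches a a≢0 | base-reaches v v≢0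
  ... | j , j<period , refl | i , _ , refl = i + (period ∸ j) , (begin
    state n c false (state n c false base j) (i + (period ∸ j)) ≡⟨ state-+ false base j (i + (period ∸ j)) ⟩
    state n c false base (i + (period ∸ j) + j)
      ≡⟨ cong (state n c false base) (trans (+-assoc i _ j) (cong (i +_) (m∸n+n≡m (<⇒≤ j<period)))) ⟩
    state n c false base (i + period)                           ≡⟨ base-periodic i ⟩
    state n c false base i                                      ∎)
    where open ≡-Reasoning

  ones-not-fixed : step false ones ≢ ones
  ones-not-fixed fixed with base-reaches ones (λ ())
  ... | j , _ , reach = no-short-period 1 ≤-refl 1<period (state-return cₙ false base 1 j (begin
    state n c false base (j + 1)   ≡⟨ cong (state n c false base) (+-comm j 1) ⟩
    step false (state n c false base j) ≡⟨ cong (step false) reach ⟩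
    step false ones                ≡⟨ fixed ⟩
    ones                           ≡⟨ reach ⟨
    state n c false base j         ∎))
    where open ≡-Reasoning

  feedback-ones : feedback n c false ones ≡ false
  feedback-ones with feedback n c false ones in eq
  ... | false = refl
  ... | true  = contradiction (trans (cong (shiftIn ones) eq) (replicate-∷ʳ n′ true)) ones-not-fixed

  feedback-complement : ∀ v → feedback n c true (map not v) ≡ not (feedback n c false v)
  feedback-complement v = begin
    feedback n c true (map not v)                               ≡⟨ feedback-xorSum< true (map not v) ⟩
    not (xorSum< n (λ j → tap j ∧ at (map not v) j))            ≡⟨ cong not (xorSum<-cong n complemented) ⟩
    not (xorSum< n (λ j → (tap j ∧ at v j) xor (tap j ∧ at ones j)))
      ≡⟨ cong not (xorSum<-xor n (λ j → tap j ∧ at v j) (λ j → tap j ∧ at ones j)) ⟩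
    not (X v xor X ones)                                        ≡⟨ cong (λ b → not (X v xor b)) X-ones ⟩
    not (X v xor false)                                         ≡⟨ cong not (xor-identityʳ (X v)) ⟩
    not (X v)                                                   ≡⟨ cong not (feedback-xorSum< false v) ⟨
    not (feedback n c false v)                                  ∎
    where
    open ≡-Reasoning
    X : Vec Bool n → Bool
    X w = xorSum< n (λ j → tap j ∧ at w j)
    X-ones : X ones ≡ false
    X-ones = trans (sym (feedback-xorSum< false ones)) feedback-ones
    complemented : ∀ j → j < n → tap j ∧ at (map not v) j ≡ (tap j ∧ at v j) xor (tap j ∧ at ones j)
    complemented j j<n = begin
      tap j ∧ at (map not v) j       ≡⟨ cong (tap j ∧_) (at-map not v j j<n) ⟩
      tap j ∧ (true xor at v j)      ≡⟨ cong (λ b → tap j ∧ (b xor at v j)) (at-replicate n true j j<n) ⟨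
      tap j ∧ (at ones j xor at v j) ≡⟨ cong (tap j ∧_) (xor-comm (at ones j) (at v j)) ⟩
      tap j ∧ (at v j xor at ones j) ≡⟨ ∧-distribˡ-xor (tap j) (at v j) (at ones j) ⟩
      (tap j ∧ at v j) xor (tap j ∧ at ones j) ∎

  state-complement : ∀ a k → state n c true (map not a) k ≡ map not (state n c false a k)
  state-complement a zero    = refl
  state-complement a (suc k) = begin
    step true (state n c true (map not a) k)     ≡⟨ cong (step true) (state-complement a k) ⟩
    step true (map not w)                        ≡⟨ cong (shiftIn (map not w)) (feedback-complement w) ⟩
    shiftIn (map not w) (not (feedback n c false w)) ≡⟨ shiftIn-map w ⟩
    map not (step false w)                       ∎
    where
    open ≡-Reasoning
    w : Vec Bool n
    w = state n c false a k
    shiftIn-map : ∀ (v : Vec Bool n) {b} → shiftIn (map not v) (not b) ≡ map not (shiftIn v b)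
    shiftIn-map (x ∷ v) {b} = sym (map-∷ʳ not b v)

  complement-involutive : ∀ {m} (v : Vec Bool m) → map not (map not v) ≡ v
  complement-involutive v = trans (sym (map-∘ not not v)) (trans (map-cong not-involutive v) (map-id v))

  complement-nonzero : ∀ {v} → v ≢ ones → map not v ≢ zeros
  complement-nonzero {v} v≢1 eq =
    v≢1 (trans (sym (complement-involutive v)) (trans (cong (map not) eq) (map-replicate not false n)))

  state-true : ∀ b₀ k → state n c true b₀ k ≡ map not (state n c false (map not b₀) k)
  state-true b₀ k =
    trans (cong (λ v → state n c true v k) (sym (complement-involutive b₀))) (state-complement (map not b₀) k)

  complement-period : ∀ b₀ → b₀ ≢ ones → state n c true b₀ period ≡ b₀
  complement-period b₀ b₀≢1 = trans (state-true b₀ period)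
    (trans (cong (map not) (nonzero-period (map not b₀) (complement-nonzero b₀≢1))) (complement-involutive b₀))

  complement-reaches : ∀ b₀ v → b₀ ≢ ones → v ≢ ones → ∃ λ k → state n c true b₀ k ≡ v
  complement-reaches b₀ v b₀≢1 v≢1
    with nonzero-reaches (map not b₀) (map not v) (complement-nonzero b₀≢1) (complement-nonzero v≢1)
  ... | k , reach = k , trans (state-true b₀ k) (trans (cong (map not) reach) (complement-involutive v))

  state-ones : ∀ k → state n c true ones k ≡ ones
  state-ones = constant-state true (cong not feedback-ones)

module Windows (n′ : ℕ) (c : Poly) (R : ℕ) (gap : ∀ i → 1 ≤ i → i ≤ 2 * R + 1 → coeff c i ≡ false) where

  open LFSR n′ c

  N : ℕ
  N = n + 2 * R + 1

  head : Vec Bool N → Vec Bool n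
  head x = tabulate (at x ∘ toℕ)

  tail : Vec Bool N → ℕ → Bool
  tail x t = at x (n + t)

  continuation : Vec Bool n → ℕ → Bool
  continuation u t = xorSum< n (λ j → tap j ∧ at u (t + j))

  tap-gap : ∀ {j t} → j < n → n ≤ t + j → t < 2 * R + 1 → tap j ≡ false
  tap-gap {j} {t} j<n n≤t+j t≤2R = gap (n ∸ j) (m<n⇒0<n∸m j<n)
    (≤-trans (subst (n ∸ j ≤_) (m+n∸n≡m t j) (∸-monoˡ-≤ j n≤t+j)) (<⇒≤ t≤2R))

  lfsr-continues : ∀ b v p {u} → state n c b v p ≡ u → ∀ t → t < 2 * R + 1 →
                   lfsr n c b v (p + (n + t)) ≡ b xor continuation u t
  lfsr-continues b v p {u} reach t t≤2R = begin
    lfsr n c b v (p + (n + t))                                  ≡⟨ cong (lfsr n c b v) (reorder p n t) ⟩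
    lfsr n c b v (p + t + n)                                    ≡⟨ lfsr-recurrence b v (p + t) ⟩
    b xor xorSum< n (λ j → tap j ∧ lfsr n c b v (p + t + j))   ≡⟨ cong (b xor_) (xorSum<-cong n known) ⟩
    b xor continuation u t                                      ∎
    where
    open ≡-Reasoning
    reorder : ∀ p n t → p + (n + t) ≡ p + t + n
    reorder = solve-∀
    known : ∀ j → j < n → tap j ∧ lfsr n c b v (p + t + j) ≡ tap j ∧ at u (t + j)
    known j j<n with t + j <? n
    ... | yes t+j<n = cong (tap j ∧_) (begin
      lfsr n c b v (p + t + j)       ≡⟨ cong (lfsr n c b v) (+-assoc p t j) ⟩
      lfsr n c b v (p + (t + j))     ≡⟨ at-state b v p (t + j) t+j<n ⟨
      at (state n c b v p) (t + j)   ≡⟨ cong (λ w → at w (t + j)) reach ⟩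
      at u (t + j)                   ∎)
    ... | no t+j≮n = trans (cong (_∧ lfsr n c b v (p + t + j)) silent) (cong (_∧ at u (t + j)) (sym silent))
      where
      silent : tap j ≡ false
      silent = tap-gap j<n (≮⇒≥ t+j≮n) t≤2R

  distance : Vec Bool N → Bool → ℕ
  distance x b = count< (2 * R + 1) (λ t → tail x t xor (b xor continuation (head x) t))

  window-distance : ∀ x b v p (f : ℕ → Bool) → state n c b v p ≡ head x →
                    (∀ j → j < N → f j ≡ lfsr n c b v (p + j)) →
                    hamming x (tabulate (f ∘ toℕ)) ≡ distance x b
  window-distance x b v p f reach follows = begin
    hamming x (tabulate (f ∘ toℕ))         ≡⟨ hamming-tabulate x f ⟩
    count< N (λ j → at x j xor f j)        ≡⟨ count<-cong N (λ j j<N → cong (at x j xor_) (follows j j<N)) ⟩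
    count< N g                             ≡⟨ cong (λ m → count< m g) (+-assoc n (2 * R) 1) ⟩
    count< (n + (2 * R + 1)) g             ≡⟨ count<-+ n (2 * R + 1) g ⟩
    count< n g + count< (2 * R + 1) (λ t → g (n + t))
      ≡⟨ cong₂ _+_ (count<-false n agree) (count<-cong (2 * R + 1) continues) ⟩
    distance x b                           ∎
    where
    open ≡-Reasoning
    g : ℕ → Bool
    g j = at x j xor lfsr n c b v (p + j)
    agree : ∀ j → j < n → g j ≡ false
    agree j j<n = trans (cong (at x j xor_) (begin
      lfsr n c b v (p + j)     ≡⟨ at-state b v p j j<n ⟨
      at (state n c b v p) j   ≡⟨ cong (λ w → at w j) reach ⟩
      at (head x) j            ≡⟨ at-tabulate (at x) j j<n ⟩
      at x j                   ∎)) (xor-same (at x j))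
    continues : ∀ t → t < 2 * R + 1 → g (n + t) ≡ tail x t xor (b xor continuation (head x) t)
    continues t t≤2R = cong (tail x t xor_) (lfsr-continues b v p reach t t≤2R)

  periodSeq-window : ∀ x b v → state n c b v period ≡ v → ∀ p → state n c b v p ≡ head x →
                     hamming x (window (periodSeq n c b v) N (p mod period)) ≡ distance x b
  periodSeq-window x b v returns p reach = window-distance x b v (p % period) f reach′ follows
    where
    f : ℕ → Bool
    f j = lfsr n c b v (toℕ ((toℕ (p mod period) + j) mod period))
    reach′ : state n c b v (p % period) ≡ head x
    reach′ = trans (periodic-% (state n c b v) period (state-periodic b v period returns) p) reach
    lfsr-periodic : ∀ k → lfsr n c b v (k + period) ≡ lfsr n c b v k
    lfsr-periodic k = cong headOr0 (state-periodic b v period returns k)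
    toℕ-mod : ∀ m → toℕ (m mod period) ≡ m % period
    toℕ-mod m = toℕ-fromℕ< (m%n<n m period)
    follows : ∀ j → j < N → f j ≡ lfsr n c b v (p % period + j)
    follows j _ = trans (cong (lfsr n c b v) (toℕ-mod (toℕ (p mod period) + j)))
      (trans (periodic-% (lfsr n c b v) period lfsr-periodic (toℕ (p mod period) + j))
             (cong (λ i → lfsr n c b v (i + j)) (toℕ-mod p)))

  constant-window : ∀ x b v → (∀ k → state n c b v k ≡ v) → v ≡ head x →
                    hamming x (window (cyc 0 (λ _ → headOr0 v)) N zero) ≡ distance x b
  constant-window x b v constant reach =
    window-distance x b v 0 (λ _ → headOr0 v) reach (λ j _ → cong headOr0 (sym (constant j)))

  continuation-close : ∀ x → ∃ λ b → distance x b ≤ R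
  continuation-close x with majority R (λ t → tail x t xor continuation (head x) t)
  ... | inj₁ close = false , close
  ... | inj₂ close = true , ≤-trans (≤-reflexive (count<-cong (2 * R + 1)
                       (λ t _ → sym (not-distribʳ-xor (tail x t) (continuation (head x) t))))) close

module Covering (n′ : ℕ) (c : Poly) (c₀ : coeff c 0 ≡ true) (cₙ : coeff c (suc n′) ≡ true)
                (len : length c ≡ suc n′ + 1) (1≤n′ : 1 ≤ n′)
                (order : ∀ e → 1 ≤ e → e < 2 ^ suc n′ ∸ 1 → ¬ (c ∣P xPowPlusOne e))
                (R : ℕ) (gap : ∀ i → 1 ≤ i → i ≤ 2 * R + 1 → coeff c i ≡ false) where

  open LFSR n′ c
  open MaximalPeriod n′ c c₀ cₙ len 1≤n′ order
  open Windows n′ c R gap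

  code : Vec Bool n → Vec Bool n → List CycSeq
  code a₀ b₀ = periodSeq n c false a₀ ∷ periodSeq n c true b₀ ∷ zeroSeq ∷ oneSeq ∷ []

  covered : ∀ {a₀ b₀} → a₀ ≢ zeros → b₀ ≢ ones → ∀ x b → distance x b ≤ R →
            ∃ λ s → s ∈ code a₀ b₀ × ∃ λ i → hamming x (window s N i) ≤ R
  covered {a₀} a₀≢0 _ x false close with ≡-dec Bool._≟_ (head x) zeros
  ... | yes u≡0 = zeroSeq , there (there (here refl)) , zero ,
    ≤-trans (≤-reflexive (constant-window x false zeros state-zeros (sym u≡0))) close
  ... | no u≢0 with nonzero-reaches a₀ (head x) a₀≢0 u≢0
  ...   | p , reach = periodSeq n c false a₀ , here refl , p mod period ,
    ≤-trans (≤-reflexive (periodSeq-window x false a₀ (nonzero-period a₀ a₀≢0) p reach)) close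
  covered {b₀ = b₀} _ b₀≢1 x true close with ≡-dec Bool._≟_ (head x) ones
  ... | yes u≡1 = oneSeq , there (there (there (here refl))) , zero ,
    ≤-trans (≤-reflexive (constant-window x true ones state-ones (sym u≡1))) close
  ... | no u≢1 with complement-reaches b₀ (head x) b₀≢1 u≢1
  ...   | p , reach = periodSeq n c true b₀ , there (here refl) , p mod period ,
    ≤-trans (≤-reflexive (periodSeq-window x true b₀ (complement-period b₀ b₀≢1) p reach)) close

  covering : ∀ a₀ → a₀ ≢ zeros → ∀ b₀ → b₀ ≢ ones → CoveringSeqCode N R (code a₀ b₀)
  covering a₀ a₀≢0 b₀ b₀≢1 x = uncurry (covered a₀≢0 b₀≢1 x) (continuation-close x)

lemma4 : (R n : ℕ) (c : Poly) →
    length c ≡ n + 1 → Primitive n c →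
    coeff c 0 ≡ true → coeff c n ≡ true →
    (∀ i → 1 ≤ i → i ≤ 2 * R + 1 → coeff c i ≡ false) →
    (a₀ : Vec Bool n) → ¬ (a₀ ≡ replicate n false) →
    (b₀ : Vec Bool n) → ¬ (b₀ ≡ replicate n true) →
    CoveringSeqCode (n + 2 * R + 1) R
      (periodSeq n c false a₀ ∷ periodSeq n c true b₀ ∷ zeroSeq ∷ oneSeq ∷ [])
lemma4 R zero c len (((i , cᵢ) , _) , _) _ _ _ _ _ _ _ =
  contradiction (trans (sym cᵢ) (coeff-≥length c (suc i) (subst (_≤ suc i) (sym len) (s≤s z≤n)))) λ ()
lemma4 R (suc zero) c _ _ _ c₁ gap _ _ _ _ =
  contradiction (trans (sym c₁) (gap 1 ≤-refl (m≤n+m 1 (2 * R)))) λ ()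
lemma4 R (suc (suc n″)) c len (_ , _ , order) c₀ cₙ gap a₀ a₀≢0 b₀ b₀≢1 =
  Covering.covering (suc n″) c c₀ cₙ len (s≤s z≤n) order R gap a₀ a₀≢0 b₀ b₀≢1
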